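{- Let $G=(V,E)$ be a graph, $\mu$ an ordinal, and $\{A_\xi:\xi<\mu\}$ a family of subsets of $V$ with $\bigcup_{\xi<\mu}A_\xi=V$ such that for each $\xi<\mu$ the induced subgraph $G[A_\xi]$ has chromatic number at most $\aleph_0$. Write $A_{<\xi}=\{A_\zeta:\zeta<\xi\}$. Suppose that for all $\xi<\mu$ and all $x\in A_\xi\setminus\bigcup A_{<\xi}$ the set $N_G(x)\cap\bigcup A_{<\xi}$ is finite. Then $G$ has chromatic number at most $\aleph_0$.
   Context: For a vertex $v$ of a graph $G=(V,E)$, $N_G(v)=\{w\in V:\{v,w\}\in E\}$. The chromatic number of a graph is the least cardinal $\kappa$ such that its vertex set is the union of $\kappa$ independent sets. -}

module Defs where

open import Level using (0ℓ)
open import Data.Nat using (ℕ)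
open import Data.Product using (Σ; ∃; _×_; Σ-syntax; ∃-syntax)
open import Data.List using (List)
open import Data.List.Membership.Propositional using (_∈_)
open import Relation.Nullary using (¬_)
open import Relation.Unary using (Pred)
open import Relation.Binary.PropositionalEquality using (_≡_)
open import Relation.Binary.Structures using (IsStrictTotalOrder)
open import Induction.WellFounded using (WellFounded)
open import Function.Bundles using (_⇔_)

record Graph : Set₁ where
  field
    V     : Set
    _~_   : V → V → Set
    ~-sym : ∀ {x y} → x ~ y → y ~ x
    ~-irr : ∀ {x} → ¬ (x ~ x)

-- An ordinal, represented (up to isomorphism) as a well-ordered set:
-- a strict total order on a carrier that is well-founded.
-- The elements of the carrier are the ordinals ξ < μ.
record Ordinal : Set₁ where
  field
    Carrier : Set
    _<_     : Carrier → Carrier → Set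
    isSTO   : IsStrictTotalOrder _≡_ _<_
    wf      : WellFounded _<_

module _ (G : Graph) where
  open Graph G

  N : V → Pred V 0ℓ
  N v w = v ~ w

  Independent : Pred V 0ℓ → Set
  Independent S = ∀ x y → S x → S y → ¬ (x ~ y)

  -- The induced subgraph G[A] has chromatic number ≤ ℵ₀:
  -- A is the union of countably many (ℕ-indexed; some may be empty)
  -- independent sets of G[A], i.e. independent subsets of A.
  ChromaticLeℵ₀ : Pred V 0ℓ → Set₁
  ChromaticLeℵ₀ A =
    Σ[ I ∈ (ℕ → Pred V 0ℓ) ]
      ((∀ n x → I n x → A x) ×
       (∀ n → Independent (I n)) ×
       (∀ x → A x → ∃[ n ] I n x))

Finite : {X : Set} → Pred X 0ℓ → Set
Finite {X} P = ∃[ xs ] (∀ (x : X) → (P x ⇔ (x ∈ xs)))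

module Submission where

-- Using excluded middle and well-foundedness of μ, every vertex
-- x has a level, the least ξ with x ∈ A_ξ.  Call y a back-neighbour of x if
-- x ~ y and y lies on a strictly lower level than x.  By hypothesis every
-- vertex has finitely many back-neighbours, and the back-neighbour relation is
-- well-founded (it decreases the level).  A well-founded, finitely branching
-- relation admits a rank into ℕ that is strictly smaller on predecessors, so
-- adjacent vertices on different levels get different ranks.  Colour x by the
-- pair (colour of x in the given colouring of its level, rank of x): adjacent
-- vertices on the same level differ in the first component, on different
-- levels in the second.  The pairs are enumerated by ℕ, giving ℕ-many
-- independent sets covering V.

open import Defs
open import Level using (0ℓ)
open import Data.Product using (∃; _×_; ∃-syntax; _,_; proj₁; proj₂)
open import Data.Product.Properties using (,-injectiveˡ; ,-injectiveʳ)
open import Relation.Nullary using (¬_; yes; no)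
open import Relation.Unary using (Pred; U)
open import Relation.Binary.Core using (Rel)
open import Axiom.ExcludedMiddle using (ExcludedMiddle)
open import Data.Nat using (ℕ; zero; suc; _+_; _≤_; _<_; s≤s)
open import Data.Nat.Properties using (m≤m+n; m≤n+m; ≤-trans; ≤-reflexive; +-suc; +-identityʳ; <-irrefl)
open import Data.Nat.ListAction using (sum)
open import Data.List using (List; _∷_)
open import Data.List.Membership.Propositional using (_∈_; mapWith∈)
open import Data.List.Membership.Propositional.Properties using (mapWith∈-cong)
open import Data.List.Relation.Unary.Any using (here; there)
open import Data.List.Relation.Unary.Any.Properties using (mapWith∈⁺)
open import Relation.Binary.PropositionalEquality using (_≡_; refl; sym; trans; cong; subst; subst₂)
open import Relation.Binary.Definitions using (tri<; tri≈; tri>)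
open import Relation.Binary.Structures using (IsStrictTotalOrder)
open import Induction.WellFounded using (WellFounded; Acc; acc; module Subrelation)
import Relation.Binary.Construct.On as On
open import Function.Bundles using (Equivalence; mk⇔)
open import Data.Empty using (⊥-elim)
open import Data.Unit using (tt)

-- Enumeration of ℕ × ℕ along the anti-diagonals c + k = d, from (d , 0) to (0 , d).

next : ℕ × ℕ → ℕ × ℕ
next (zero  , k) = (suc k , 0)
next (suc c , k) = (c , suc k)

unpair : ℕ → ℕ × ℕ
unpair zero    = (0 , 0)
unpair (suc n) = next (unpair n)

Enumerated : ℕ × ℕ → Set
Enumerated p = ∃[ n ] unpair n ≡ p

private
  step : ∀ {p} → Enumerated p → Enumerated (next p)
  step (n , e) = suc n , cong next e

diagonal-walk : ∀ k c → Enumerated (c + k , 0) → Enumerated (c , k)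
diagonal-walk zero    c e = subst (λ d → Enumerated (d , 0)) (+-identityʳ c) e
diagonal-walk (suc k) c e =
  step (diagonal-walk k (suc c) (subst (λ d → Enumerated (d , 0)) (+-suc c k) e))

-- Each anti-diagonal starts right after the end (0 , d) of the previous one.
axis-enumerated : ∀ d → Enumerated (d , 0)
axis-enumerated zero    = 0 , refl
axis-enumerated (suc d) = step (diagonal-walk d 0 (axis-enumerated d))

unpair-surjective : ∀ c k → Enumerated (c , k)
unpair-surjective c k = diagonal-walk k c (axis-enumerated (c + k))

∈⇒≤sum : ∀ {n ns} → n ∈ ns → n ≤ sum ns
∈⇒≤sum {ns = m ∷ ms} (here refl) = m≤m+n m (sum ms)
∈⇒≤sum {ns = m ∷ ms} (there p)   = ≤-trans (∈⇒≤sum p) (m≤n+m (sum ms) m)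

module Rank {X : Set} (_⊏_ : Rel X 0ℓ) (wf : WellFounded _⊏_)
            (finite : ∀ x → Finite (_⊏ x)) where

  predecessors : X → List X
  predecessors x = proj₁ (finite x)

  predecessor-listed : ∀ {x y} → y ⊏ x → y ∈ predecessors x
  predecessor-listed {x} {y} y⊏x = Equivalence.to (proj₂ (finite x) y) y⊏x

  listed-predecessor : ∀ {x y} → y ∈ predecessors x → y ⊏ x
  listed-predecessor {x} {y} y∈ = Equivalence.from (proj₂ (finite x) y) y∈

  rankAcc : ∀ x → Acc _⊏_ x → ℕ
  rankAcc x (acc rs) =
    suc (sum (mapWith∈ (predecessors x) (λ {y} y∈ → rankAcc y (rs (listed-predecessor y∈)))))

  rankAcc-irrelevant : ∀ x (a b : Acc _⊏_ x) → rankAcc x a ≡ rankAcc x b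
  rankAcc-irrelevant x (acc rs) (acc rs′) =
    cong (λ ns → suc (sum ns))
      (mapWith∈-cong (predecessors x) _ _ (λ {y} _ → rankAcc-irrelevant y _ _))

  rank : X → ℕ
  rank x = rankAcc x (wf x)

  rank-increasing : ∀ {x y} → y ⊏ x → rank y < rank x
  rank-increasing {x} {y} y⊏x = go (wf x)
    where
    go : (a : Acc _⊏_ x) → rank y < rankAcc x a
    go (acc rs) = s≤s (≤-trans (≤-reflexive (rankAcc-irrelevant y _ _))
                               (∈⇒≤sum (mapWith∈⁺ _ (y , predecessor-listed y⊏x , refl))))

module Minimality {C : Set} (_≺_ : Rel C 0ℓ) where

  Minimal : Pred C 0ℓ → Pred C 0ℓ
  Minimal P ξ = P ξ × ¬ (∃[ ζ ] (ζ ≺ ξ × P ζ))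

  minimal-exists : ExcludedMiddle 0ℓ → WellFounded _≺_ →
                   (P : Pred C 0ℓ) → ∀ {ξ} → P ξ → ∃ (Minimal P)
  minimal-exists lem wf P {ξ} = descend ξ (wf ξ)
    where
    descend : ∀ ξ → Acc _≺_ ξ → P ξ → ∃ (Minimal P)
    descend ξ (acc rs) Pξ with lem {∃[ ζ ] (ζ ≺ ξ × P ζ)}
    ... | yes (ζ , ζ≺ξ , Pζ) = descend ζ (rs ζ≺ξ) Pζ
    ... | no  none-below     = ξ , Pξ , none-below

  minimal-below : IsStrictTotalOrder _≡_ _≺_ → ∀ {P ξ₀ ζ ξ} →
                  Minimal P ξ₀ → P ζ → ζ ≺ ξ → ξ₀ ≺ ξ
  minimal-below sto {ξ₀ = ξ₀} {ζ} (_ , none-below) Pζ ζ≺ξ with compare ξ₀ ζ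
    where open IsStrictTotalOrder sto using (compare)
  ... | tri< ξ₀≺ζ _ _ = IsStrictTotalOrder.trans sto ξ₀≺ζ ζ≺ξ
  ... | tri≈ _ refl _ = ζ≺ξ
  ... | tri> _ _ ζ≺ξ₀ = ⊥-elim (none-below (ζ , ζ≺ξ₀ , Pζ))

module Colouring (lem : ExcludedMiddle 0ℓ) (G : Graph) (μ : Ordinal)
    (A : Ordinal.Carrier μ → Pred (Graph.V G) 0ℓ)
    (cover : ∀ v → ∃[ ξ ] A ξ v)
    (chromatic : ∀ ξ → ChromaticLeℵ₀ G (A ξ))
    (finite : ∀ ξ x → A ξ x → ¬ (∃[ ζ ] (Ordinal._<_ μ ζ ξ × A ζ x)) →
      Finite (λ y → Graph._~_ G x y × ∃[ ζ ] (Ordinal._<_ μ ζ ξ × A ζ y))) where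
  open Graph G
  open Ordinal μ renaming (Carrier to C; _<_ to _≺_)
  open Minimality _≺_

  level-exists : ∀ x → ∃ (Minimal (λ ξ → A ξ x))
  level-exists x = minimal-exists lem wf (λ ξ → A ξ x) (proj₂ (cover x))

  level : V → C
  level x = proj₁ (level-exists x)

  level-minimal : ∀ x → Minimal (λ ξ → A ξ x) (level x)
  level-minimal x = proj₂ (level-exists x)

  _⊏_ : Rel V 0ℓ
  y ⊏ x = x ~ y × level y ≺ level x

  back-wellFounded : WellFounded _⊏_
  back-wellFounded = Subrelation.wellFounded proj₂ (On.wellFounded level wf)

  -- The back-neighbours of x are exactly the neighbours of x in ⋃ A_{<level x},
  -- a finite set by hypothesis.
  back-finite : ∀ x → Finite (_⊏ x)
  back-finite x = neighbours , λ y → mk⇔ (to y) (from y)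
    where
    earlier : Finite (λ y → x ~ y × ∃[ ζ ] (ζ ≺ level x × A ζ y))
    earlier = finite (level x) x (proj₁ (level-minimal x)) (proj₂ (level-minimal x))
    neighbours : List V
    neighbours = proj₁ earlier
    to : ∀ y → y ⊏ x → y ∈ neighbours
    to y (x~y , lt) = Equivalence.to (proj₂ earlier y) (x~y , level y , lt , proj₁ (level-minimal y))
    from : ∀ y → y ∈ neighbours → y ⊏ x
    from y y∈ with Equivalence.from (proj₂ earlier y) y∈
    ... | x~y , ζ , ζ≺ , y∈Aζ = x~y , minimal-below isSTO (level-minimal y) y∈Aζ ζ≺

  open Rank _⊏_ back-wellFounded back-finite

  levelClass : C → ℕ → Pred V 0ℓ
  levelClass ξ = proj₁ (chromatic ξ)

  levelClass-independent : ∀ ξ n → Independent G (levelClass ξ n)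
  levelClass-independent ξ = proj₁ (proj₂ (proj₂ (chromatic ξ)))

  levelClass-covers : ∀ ξ x → A ξ x → ∃[ n ] levelClass ξ n x
  levelClass-covers ξ = proj₂ (proj₂ (proj₂ (chromatic ξ)))

  colour-exists : ∀ x → ∃[ n ] levelClass (level x) n x
  colour-exists x = levelClass-covers (level x) x (proj₁ (level-minimal x))

  colour : V → ℕ
  colour x = proj₁ (colour-exists x)

  Class : ℕ → Pred V 0ℓ
  Class n x = unpair n ≡ (colour x , rank x)

  same-class : ∀ n {x y} → Class n x → Class n y → colour x ≡ colour y × rank x ≡ rank y
  same-class n cx cy = ,-injectiveˡ same-pair , ,-injectiveʳ same-pair
    where same-pair = trans (sym cx) cy

  -- Within one level, a class of G lies inside a class of G[A_ξ].
  same-level-independent : ∀ n {x y} → Class n x → Class n y → level x ≡ level y → ¬ (x ~ y)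
  same-level-independent n {x} {y} cx cy same-level =
    levelClass-independent (level x) (colour x) x y (proj₂ (colour-exists x)) y-in-class
    where
    y-in-class : levelClass (level x) (colour x) y
    y-in-class = subst₂ (λ ξ k → levelClass ξ k y)
                        (sym same-level) (sym (proj₁ (same-class n cx cy))) (proj₂ (colour-exists y))

  -- Adjacent vertices on different levels are separated by their ranks.
  class-independent : ∀ n → Independent G (Class n)
  class-independent n x y cx cy x~y with compare (level x) (level y)
    where open IsStrictTotalOrder isSTO using (compare)
  ... | tri< lt _ _ = <-irrefl (proj₂ (same-class n cx cy)) (rank-increasing (~-sym x~y , lt))
  ... | tri≈ _ eq _ = same-level-independent n cx cy eq x~y
  ... | tri> _ _ gt = <-irrefl (proj₂ (same-class n cy cx)) (rank-increasing (x~y , gt))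

  class-covers : ∀ x → ∃[ n ] Class n x
  class-covers x = unpair-surjective (colour x) (rank x)

mainTheorem2 : ExcludedMiddle 0ℓ →
    (G : Graph) → (μ : Ordinal) →
    (A : Ordinal.Carrier μ → Pred (Graph.V G) 0ℓ) →
    (∀ v → ∃[ ξ ] A ξ v) →
    (∀ ξ → ChromaticLeℵ₀ G (A ξ)) →
    (∀ ξ x → A ξ x → ¬ (∃[ ζ ] (Ordinal._<_ μ ζ ξ × A ζ x)) →
    Finite (λ y → Graph._~_ G x y × ∃[ ζ ] (Ordinal._<_ μ ζ ξ × A ζ y))) →
    ChromaticLeℵ₀ G U
mainTheorem2 lem G μ A cover chromatic finite =
  Class , (λ _ _ _ → tt) , class-independent , (λ x _ → class-covers x)
  where open Colouring lem G μ A cover chromatic finite
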